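{- Suppose that $\mathcal{F}\subset\binom{[n]}{4}$ satisfies $\gamma_3(\mathcal{F})\geq 3$ and $|F\cap F'|=1$ for all distinct $F,F'\in\mathcal{F}$. Then $\mathcal{F}$ is isomorphic to $\mathcal{L}_3$.
   Context: $\gamma_3(\mathcal{F})=\min_{S\in\binom{[n]}{3}}|\{F\in\mathcal{F}:F\cap S=\emptyset\}|$. $\mathcal{L}_3$ (the projective plane of order 3) is the family $\{\{i,i+1,i+3,i+9\}: i\in\mathbb{Z}_{13}\}$ on the ground set $\mathbb{Z}_{13}$, with addition modulo 13. Isomorphism means equality up to a bijection between ground sets (restricted to the vertices covered by the families). -}

module Defs where

open import Data.Nat using (ℕ; _+_; _≤_)
open import Data.Nat.DivMod using (_mod_)
open import Data.Fin using (Fin; toℕ)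
open import Data.Fin.Subset using (Subset; ⊥; ⁅_⁆; _∪_; _∩_; ∣_∣)
open import Data.Bool using (Bool)
import Data.Bool.Properties as BoolP
open import Data.Vec.Properties using (≡-dec)
open import Data.List using (List; []; _∷_; foldr; filter; length)
open import Data.List.Membership.Propositional using (_∈_)
open import Data.List.Relation.Unary.Unique.Propositional using (Unique)
open import Data.List.Relation.Unary.All using (All)
open import Data.Product using (Σ; ∃; _×_)
open import Relation.Binary.PropositionalEquality using (_≡_; _≢_)
open import Relation.Nullary using (Dec)
open import Function.Definitions using (Injective)

-- A family of subsets of [n] = Fin n, given as a duplicate-free list of subsets.
Family : ℕ → Set
Family n = List (Subset n)

_≟S_ : ∀ {n} → (A B : Subset n) → Dec (A ≡ B)
_≟S_ = ≡-dec BoolP._≟_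

avoidCount : ∀ {n} → Subset n → Family n → ℕ
avoidCount S 𝓕 = length (filter (λ F → (F ∩ S) ≟S ⊥) 𝓕)

-- γ₃(𝓕) ≥ k : the minimum over 3-subsets S of avoidCount S 𝓕 is at least k
-- (unfolding of the minimum; used together with n ≥ 3 so the minimum exists).
γ₃≥ : ∀ {n} → ℕ → Family n → Set
γ₃≥ {n} k 𝓕 = (S : Subset n) → ∣ S ∣ ≡ 3 → k ≤ avoidCount S 𝓕

FourUniform : ∀ {n} → Family n → Set
FourUniform 𝓕 = All (λ F → ∣ F ∣ ≡ 4) 𝓕

PairwiseMeetOnce : ∀ {n} → Family n → Set
PairwiseMeetOnce 𝓕 = ∀ {F F'} → F ∈ 𝓕 → F' ∈ 𝓕 → F ≢ F' → ∣ F ∩ F' ∣ ≡ 1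

-- The projective plane of order 3: lines {i, i+1, i+3, i+9} in ℤ₁₃.
L3pts : Fin 13 → List (Fin 13)
L3pts i = ((toℕ i + 0) mod 13) ∷ ((toℕ i + 1) mod 13) ∷ ((toℕ i + 3) mod 13)
          ∷ ((toℕ i + 9) mod 13) ∷ []

imageLine : ∀ {n} → (Fin 13 → Fin n) → Fin 13 → Subset n
imageLine f i = foldr (λ x s → ⁅ f x ⁆ ∪ s) ⊥ (L3pts i)

-- 𝓕 ≅ 𝓛₃: there is a bijection between the vertices covered by 𝓛₃ (all of ℤ₁₃)
-- and those covered by 𝓕, i.e. an injection f : ℤ₁₃ → [n] mapping 𝓛₃ onto 𝓕.
IsoL3 : ∀ {n} → Family n → Set
IsoL3 {n} 𝓕 = Σ (Fin 13 → Fin n) λ f →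
  Injective _≡_ _≡_ f
  × ((i : Fin 13) → imageLine f i ∈ 𝓕)
  × (∀ {F} → F ∈ 𝓕 → ∃ λ i → F ≡ imageLine f i)

-- Through a point o of a line F pass four lines: by γ₃ ≥ 3 three lines miss the 3-set
-- F - o, and each meets F, necessarily at o.  Call them L 0, …, L 3, label the points other
-- than o on L 0 and L 1 by ℤ/3 as a i and c j, and let T i j be a line through a i and c j
-- (the four lines through a i cut L 1 in four distinct points, which exhaust it).  Every
-- line is an L g or a T i j.  Writing κ g i j ∈ ℤ/3 for the label of the point where T i j
-- crosses L g, any two of the maps κ g are orthogonal, since two points determine a line.
-- Labelling L 2 along the T 0 k and L 3 along the T k 0, orthogonality forces
-- κ 2 i j = j + s i and κ 3 i j = i − s j with s = ±1: the projective plane of order 3 in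
-- affine coordinates, which a computed table identifies with 𝓛₃.

module Submission where

open import Data.Nat as ℕ using (ℕ; zero; suc; _≤_; s≤s)
open import Data.Nat.DivMod using (_mod_)
open import Data.Nat.Properties using (suc-injective; ≤⇒≯; ≤-reflexive)
open import Data.Fin using (Fin; zero; suc; toℕ; inject≤; _≟_)
open import Data.Fin.Patterns using (0F; 1F; 2F; 3F)
open import Data.Fin.Properties using (all?; any?; inject≤-injective)
open import Data.Fin.Subset
  using (Subset; _∈_; _∉_; _⊆_; ⁅_⁆; _∪_; _∩_; _-_; ⊥; ∣_∣; inside; outside; Nonempty)
open import Data.Fin.Subset.Properties
  using ( _∈?_; ∉⊥; x∈⁅y⁆⇒x≡y; x∈p∪q⁻; x∈p∩q⁺; x∈p∩q⁻; ∪-identityˡ; p─⊥≡p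
        ; p─q⊆p; x∈p∧x≢y⇒x∈p-y; p⊂q⇒∣p∣<∣q∣; drop-not-there; nonempty?; Empty-unique
        ; ∣⊥∣≡0; ⊆-antisym)
open import Data.Vec using (Vec; []; _∷_; here; there; lookup)
open import Data.Vec.Functional using () renaming (_∷_ to _◃_)
open import Data.List using (List; []; _∷_; foldr; length; allFin; filter)
open import Data.List.Properties using (length-tabulate)
open import Data.List.Membership.Propositional using () renaming (_∈_ to _∈ₗ_)
open import Data.List.Membership.Propositional.Properties using (∈-filter⁻)
open import Data.List.Relation.Unary.Any using (here; there)
open import Data.List.Relation.Unary.All using (All)
import Data.List.Relation.Unary.All as All
open import Data.List.Relation.Unary.AllPairs using (allPairs?)
open import Data.List.Relation.Unary.Unique.Propositional using (Unique; []; _∷_)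
open import Data.List.Relation.Unary.Unique.Propositional.Properties using (allFin⁺; filter⁺)
open import Data.Maybe using (Maybe; just; nothing)
import Data.Maybe.Properties as Maybe
open import Data.Product using (Σ; ∃; ∃₂; _×_; _,_; proj₁; proj₂)
import Data.Product.Properties as Product
open import Data.Sum using (_⊎_; inj₁; inj₂; [_,_]′)
import Data.Sum.Properties as Sum
open import Data.Unit using (⊤; tt)
open import Data.Empty using () renaming (⊥ to Empty)
open import Function using (_∘_)
open import Function.Definitions using (Injective)
open import Relation.Binary.Definitions using (DecidableEquality)
open import Relation.Binary.PropositionalEquality using (_≡_; _≢_; refl; sym; trans; cong; subst)
open import Relation.Nullary using (Dec; yes; no; contradiction)
open import Relation.Nullary.Decidable
  using (from-yes; decidable-stable; ¬?; _→-dec_; _×-dec_; _⊎-dec_)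
open import Defs

private
  variable
    A : Set
    n k : ℕ
    p q : Subset n
    x y : Fin n

-- Finite subsets

∣⁅x⁆∪p∣≡1+∣p∣ : x ∉ p → ∣ ⁅ x ⁆ ∪ p ∣ ≡ suc ∣ p ∣
∣⁅x⁆∪p∣≡1+∣p∣ {x = zero} {p = inside ∷ p} x∉p = contradiction here x∉p
∣⁅x⁆∪p∣≡1+∣p∣ {x = zero} {p = outside ∷ p} x∉p = cong (λ q → suc ∣ q ∣) (∪-identityˡ p)
∣⁅x⁆∪p∣≡1+∣p∣ {x = suc x} {p = inside ∷ p} x∉p = cong suc (∣⁅x⁆∪p∣≡1+∣p∣ (drop-not-there x∉p))
∣⁅x⁆∪p∣≡1+∣p∣ {x = suc x} {p = outside ∷ p} x∉p = ∣⁅x⁆∪p∣≡1+∣p∣ (drop-not-there x∉p)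

x∈p⇒suc∣p-x∣≡∣p∣ : x ∈ p → suc ∣ p - x ∣ ≡ ∣ p ∣
x∈p⇒suc∣p-x∣≡∣p∣ {p = inside ∷ p} here = cong (λ q → suc ∣ q ∣) (p─⊥≡p p)
x∈p⇒suc∣p-x∣≡∣p∣ {p = inside ∷ p} (there x∈p) = cong suc (x∈p⇒suc∣p-x∣≡∣p∣ x∈p)
x∈p⇒suc∣p-x∣≡∣p∣ {p = outside ∷ p} (there x∈p) = x∈p⇒suc∣p-x∣≡∣p∣ x∈p

x∉p-x : x ∉ p - x
x∉p-x {p = _ ∷ p} (there x∈p-x) = x∉p-x {p = p} x∈p-x

x∈p-y⇒x≢y : x ∈ p - y → x ≢ y
x∈p-y⇒x≢y {p = p} x∈p-x refl = x∉p-x {p = p} x∈p-x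

∣p∣≡suc⇒nonempty : (p : Subset n) → ∣ p ∣ ≡ suc k → Nonempty p
∣p∣≡suc⇒nonempty {n} p ∣p∣≡1+k with nonempty? p
... | yes nonempty = nonempty
... | no empty = contradiction
  (trans (sym ∣p∣≡1+k) (trans (cong ∣_∣ (Empty-unique empty)) (∣⊥∣≡0 n))) λ ()

p⊆q∧∣q∣≤∣p∣⇒q⊆p : p ⊆ q → ∣ q ∣ ≤ ∣ p ∣ → q ⊆ p
p⊆q∧∣q∣≤∣p∣⇒q⊆p {p = p} p⊆q ∣q∣≤∣p∣ {x} x∈q with x ∈? p
... | yes x∈p = x∈p
... | no x∉p = contradiction (p⊂q⇒∣p∣<∣q∣ (p⊆q , x , x∈q , x∉p)) (≤⇒≯ ∣q∣≤∣p∣)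

image : (A → Fin n) → List A → Subset n
image f = foldr (λ a s → ⁅ f a ⁆ ∪ s) ⊥

module _ {f : A → Fin n} where

  ∈-image⁻ : ∀ as → y ∈ image f as → ∃ λ a → a ∈ₗ as × y ≡ f a
  ∈-image⁻ [] y∈ = contradiction y∈ ∉⊥
  ∈-image⁻ (a ∷ as) y∈ with x∈p∪q⁻ ⁅ f a ⁆ (image f as) y∈
  ... | inj₁ y∈⁅fa⁆ = a , here refl , x∈⁅y⁆⇒x≡y _ y∈⁅fa⁆
  ... | inj₂ y∈img with ∈-image⁻ as y∈img
  ...   | b , b∈as , y≡fb = b , there b∈as , y≡fb

  ∣image∣≡length : Injective _≡_ _≡_ f → ∀ {as} → Unique as → ∣ image f as ∣ ≡ length as
  ∣image∣≡length f-inj [] = ∣⊥∣≡0 n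
  ∣image∣≡length f-inj {a ∷ as} (a∉as ∷ as!) =
    trans (∣⁅x⁆∪p∣≡1+∣p∣ fa∉img) (cong suc (∣image∣≡length f-inj as!))
    where
      fa∉img : f a ∉ image f as
      fa∉img fa∈img with ∈-image⁻ as fa∈img
      ... | b , b∈as , fa≡fb = All.lookup a∉as b∈as (f-inj fa≡fb)

-- Opaque, so that type checking never unfolds the witnesses these lemmas produce.
opaque
  injection-covers : {e : Fin k → Fin n} → Injective _≡_ _≡_ e → (∀ i → e i ∈ p) → ∣ p ∣ ≤ k
    → x ∈ p → ∃ λ i → x ≡ e i
  injection-covers {k = k} {p = p} {e = e} e-inj e∈p ∣p∣≤k x∈p with ∈-image⁻ (allFin k) (p⊆img x∈p)
    where
      img⊆p : image e (allFin k) ⊆ p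
      img⊆p y∈img with ∈-image⁻ (allFin k) y∈img
      ... | i , _ , refl = e∈p i
      ∣img∣≡k : ∣ image e (allFin k) ∣ ≡ k
      ∣img∣≡k = trans (∣image∣≡length e-inj (allFin⁺ k)) (length-tabulate (λ i → i))
      p⊆img : p ⊆ image e (allFin k)
      p⊆img = p⊆q∧∣q∣≤∣p∣⇒q⊆p img⊆p (subst (∣ p ∣ ≤_) (sym ∣img∣≡k) ∣p∣≤k)
  ... | i , _ , x≡ei = i , x≡ei

injective-◃ : {g : Fin k → A} {a : A} → Injective _≡_ _≡_ g → (∀ i → g i ≢ a)
  → Injective _≡_ _≡_ (a ◃ g)
injective-◃ g-inj g≢a {zero} {zero} _ = refl
injective-◃ g-inj g≢a {zero} {suc j} a≡gj = contradiction (sym a≡gj) (g≢a j)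
injective-◃ g-inj g≢a {suc i} {zero} gi≡a = contradiction gi≡a (g≢a i)
injective-◃ g-inj g≢a {suc i} {suc j} gi≡gj = cong suc (g-inj gi≡gj)

pick-distinct : ∀ {as : List A} → Unique as → k ≤ length as
  → Σ (Fin k → A) λ g → Injective _≡_ _≡_ g × (∀ i → g i ∈ₗ as)
pick-distinct {k = zero} _ _ = (λ ()) , (λ { {()} }) , λ ()
pick-distinct {k = suc k} {a ∷ as} (a∉as ∷ as!) (s≤s k≤∣as∣) with pick-distinct as! k≤∣as∣
... | g , g-inj , g∈as = a ◃ g , injective-◃ g-inj (λ i gi≡a → All.lookup a∉as (g∈as i) (sym gi≡a)) ,
      λ { zero → here refl ; (suc i) → there (g∈as i) }

opaque
  enumerate : (p : Subset n) → ∣ p ∣ ≡ k → Σ (Fin k → Fin n) λ e → Injective _≡_ _≡_ e × (∀ i → e i ∈ p)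
  enumerate {k = zero} _ _ = (λ ()) , (λ { {()} }) , λ ()
  enumerate {k = suc k} p ∣p∣≡1+k with ∣p∣≡suc⇒nonempty p ∣p∣≡1+k
  ... | x , x∈p with enumerate (p - x) (suc-injective (trans (x∈p⇒suc∣p-x∣≡∣p∣ x∈p) ∣p∣≡1+k))
  ...   | e , e-inj , e∈p-x =
    x ◃ e , injective-◃ e-inj (λ i ei≡x → x∉p-x (subst (_∈ p - x) ei≡x (e∈p-x i))) ,
    λ { zero → x∈p ; (suc i) → p─q⊆p p ⁅ x ⁆ (e∈p-x i) }

-- Pairwise orthogonal maps ℤ/3 × ℤ/3 → ℤ/3

F3 : Set
F3 = Fin 3

infixl 6 _⊕_
infixl 7 _⊗_

_⊕_ : F3 → F3 → F3
i ⊕ j = (toℕ i ℕ.+ toℕ j) mod 3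

_⊗_ : F3 → F3 → F3
i ⊗ j = (toℕ i ℕ.* toℕ j) mod 3

⟨_,_,_⟩ : F3 → F3 → F3 → F3 → F3
⟨ x , y , z ⟩ 0F = x
⟨ x , y , z ⟩ 1F = y
⟨ x , y , z ⟩ 2F = z

Orthogonal : (F3 → F3 → F3) → (F3 → F3 → F3) → Set
Orthogonal φ ψ = ∀ i j i' j' → φ i j ≡ φ i' j' → ψ i j ≡ ψ i' j' → i ≡ i' × j ≡ j'

orthogonal? : ∀ φ ψ → Dec (Orthogonal φ ψ)
orthogonal? φ ψ = all? λ i → all? λ j → all? λ i' → all? λ j' →
  (φ i j ≟ φ i' j') →-dec (ψ i j ≟ ψ i' j') →-dec ((i ≟ i') ×-dec (j ≟ j'))

permutation-is-shift : ∀ x y z → x ≢ y → x ≢ z → y ≢ z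
  → (x ≡ 0F ⊎ y ≡ 1F ⊎ z ≡ 2F → x ≡ 0F × y ≡ 1F × z ≡ 2F)
  → x ≡ 0F ⊕ x × y ≡ 1F ⊕ x × z ≡ 2F ⊕ x
permutation-is-shift = from-yes (all? λ x → all? λ y → all? λ z →
  ¬? (x ≟ y) →-dec ¬? (x ≟ z) →-dec ¬? (y ≟ z)
  →-dec (((x ≟ 0F) ⊎-dec (y ≟ 1F) ⊎-dec (z ≟ 2F)) →-dec (x ≟ 0F) ×-dec (y ≟ 1F) ×-dec (z ≟ 2F))
  →-dec (x ≟ 0F ⊕ x) ×-dec (y ≟ 1F ⊕ x) ×-dec (z ≟ 2F ⊕ x))

orthogonal-shifts : ∀ σ₁ σ₂ τ₁ τ₂ → let σ = ⟨ 0F , σ₁ , σ₂ ⟩ ; τ = ⟨ 0F , τ₁ , τ₂ ⟩ in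
  Orthogonal (λ i j → j) (λ i j → j ⊕ σ i) → Orthogonal (λ i j → i) (λ i j → i ⊕ τ j)
  → Orthogonal (λ i j → j ⊕ σ i) (λ i j → i ⊕ τ j)
  → (σ₁ ≡ 1F ⊎ σ₁ ≡ 2F) × (∀ i → σ i ≡ σ₁ ⊗ i) × (∀ j → τ j ≡ 2F ⊗ σ₁ ⊗ j)
orthogonal-shifts = from-yes (all? λ σ₁ → all? λ σ₂ → all? λ τ₁ → all? λ τ₂ →
  let σ = ⟨ 0F , σ₁ , σ₂ ⟩ ; τ = ⟨ 0F , τ₁ , τ₂ ⟩ in
  orthogonal? (λ i j → j) (λ i j → j ⊕ σ i) →-dec orthogonal? (λ i j → i) (λ i j → i ⊕ τ j)
  →-dec orthogonal? (λ i j → j ⊕ σ i) (λ i j → i ⊕ τ j)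
  →-dec ((σ₁ ≟ 1F) ⊎-dec (σ₁ ≟ 2F)) ×-dec (all? λ i → σ i ≟ σ₁ ⊗ i)
        ×-dec (all? λ j → τ j ≟ 2F ⊗ σ₁ ⊗ j))

orthogonal-cong : ∀ {φ φ' ψ ψ'} → (∀ i j → φ i j ≡ φ' i j) → (∀ i j → ψ i j ≡ ψ' i j)
  → Orthogonal φ ψ → Orthogonal φ' ψ'
orthogonal-cong φ≗ ψ≗ orth i j i' j' φ≡ ψ≡ =
  orth i j i' j' (trans (φ≗ i j) (trans φ≡ (sym (φ≗ i' j'))))
                 (trans (ψ≗ i j) (trans ψ≡ (sym (ψ≗ i' j'))))

injective-is-shift : (g : F3 → F3) → Injective _≡_ _≡_ g → (∀ j → g j ≡ j → ∀ k → g k ≡ k)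
  → ∀ j → g j ≡ j ⊕ g 0F
injective-is-shift g g-inj fixed = pick (permutation-is-shift (g 0F) (g 1F) (g 2F)
  (λ e → 0≢1 (g-inj e)) (λ e → 0≢2 (g-inj e)) (λ e → 1≢2 (g-inj e))
  (λ fixed-point → let g≗id = [ fixed 0F , [ fixed 1F , fixed 2F ]′ ]′ fixed-point
                   in g≗id 0F , g≗id 1F , g≗id 2F))
  where
    0≢1 : 0F ≢ 1F
    0≢1 ()
    0≢2 : 0F ≢ 2F
    0≢2 ()
    1≢2 : 1F ≢ 2F
    1≢2 ()
    pick : g 0F ≡ 0F ⊕ g 0F × g 1F ≡ 1F ⊕ g 0F × g 2F ≡ 2F ⊕ g 0F → ∀ j → g j ≡ j ⊕ g 0F
    pick (e , _ , _) 0F = e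
    pick (_ , e , _) 1F = e
    pick (_ , _ , e) 2F = e

-- Dually, transversal i j is the point (i , j) of the affine plane (ℤ/3)², axis g a parallel
-- class, and its k-th line has equation i = k, j = k, j + s i = k or i − s j = k (2 = −1).
coordinate : F3 → Fin 4 → F3 → F3 → F3
coordinate s 0F i j = i
coordinate s 1F i j = j
coordinate s 2F i j = j ⊕ s ⊗ i
coordinate s 3F i j = i ⊕ 2F ⊗ s ⊗ j

PairwiseOrthogonal : (Fin 4 → F3 → F3 → F3) → Set
PairwiseOrthogonal κ = ∀ g h → g ≢ h → Orthogonal (κ g) (κ h)

Normalised : (Fin 4 → F3 → F3 → F3) → Set
Normalised κ = (∀ i j → κ 0F i j ≡ i) × (∀ i j → κ 1F i j ≡ j)
             × (∀ j → κ 2F 0F j ≡ j) × (∀ i → κ 3F i 0F ≡ i)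

module _ {κ : Fin 4 → F3 → F3 → F3} (orth : PairwiseOrthogonal κ) where

  rows-are-shifts : Normalised κ → ∀ i j → κ 2F i j ≡ j ⊕ κ 2F i 0F
  rows-are-shifts (κ₀ , κ₁ , κ₂ , _) i = injective-is-shift (κ 2F i)
    (λ {j} {j'} e → proj₂ (orth 0F 2F (λ ()) i j i j' (trans (κ₀ i j) (sym (κ₀ i j'))) e))
    (λ j e k → subst (λ i → κ 2F i k ≡ k)
      (sym (proj₁ (orth 1F 2F (λ ()) i j 0F j (trans (κ₁ i j) (sym (κ₁ 0F j))) (trans e (sym (κ₂ j))))))
      (κ₂ k))

  columns-are-shifts : Normalised κ → ∀ i j → κ 3F i j ≡ i ⊕ κ 3F 0F j
  columns-are-shifts (κ₀ , κ₁ , _ , κ₃) i j = injective-is-shift (λ i → κ 3F i j)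
    (λ {i} {i'} e → proj₁ (orth 1F 3F (λ ()) i j i' j (trans (κ₁ i j) (sym (κ₁ i' j))) e))
    (λ i e k → subst (λ j → κ 3F k j ≡ k)
      (sym (proj₂ (orth 0F 3F (λ ()) i j i 0F (trans (κ₀ i j) (sym (κ₀ i 0F))) (trans e (sym (κ₃ i))))))
      (κ₃ k))
    i

  normal-form : Normalised κ → ∃ λ s → (s ≡ 1F ⊎ s ≡ 2F) × (∀ g i j → κ g i j ≡ coordinate s g i j)
  normal-form normalised@(κ₀ , κ₁ , κ₂ , κ₃) = s , proj₁ shifts , agrees
    where
      s : F3
      s = κ 2F 1F 0F
      σ τ : F3 → F3
      σ = ⟨ 0F , s , κ 2F 2F 0F ⟩
      τ = ⟨ 0F , κ 3F 0F 1F , κ 3F 0F 2F ⟩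
      σ-column : ∀ i → κ 2F i 0F ≡ σ i
      σ-column 0F = κ₂ 0F
      σ-column 1F = refl
      σ-column 2F = refl
      τ-row : ∀ j → κ 3F 0F j ≡ τ j
      τ-row 0F = κ₃ 0F
      τ-row 1F = refl
      τ-row 2F = refl
      β : ∀ i j → κ 2F i j ≡ j ⊕ σ i
      β i j = trans (rows-are-shifts normalised i j) (cong (j ⊕_) (σ-column i))
      δ : ∀ i j → κ 3F i j ≡ i ⊕ τ j
      δ i j = trans (columns-are-shifts normalised i j) (cong (i ⊕_) (τ-row j))
      shifts : (s ≡ 1F ⊎ s ≡ 2F) × (∀ i → σ i ≡ s ⊗ i) × (∀ j → τ j ≡ 2F ⊗ s ⊗ j)
      shifts = orthogonal-shifts s (κ 2F 2F 0F) (κ 3F 0F 1F) (κ 3F 0F 2F)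
        (orthogonal-cong κ₁ β (orth 1F 2F (λ ())))
        (orthogonal-cong κ₀ δ (orth 0F 3F (λ ())))
        (orthogonal-cong β δ (orth 2F 3F (λ ())))
      agrees : ∀ g i j → κ g i j ≡ coordinate s g i j
      agrees 0F = κ₀
      agrees 1F = κ₁
      agrees 2F i j = trans (β i j) (cong (j ⊕_) (proj₁ (proj₂ shifts) i))
      agrees 3F i j = trans (δ i j) (cong (i ⊕_) (proj₂ (proj₂ shifts) j))

-- The projective plane of order 3 and 𝓛₃

Point : Set
Point = Maybe (Fin 4 × F3)

pattern centre = nothing
pattern mark g k = just (g , k)

Line : Set
Line = Fin 4 ⊎ (F3 × F3)

pattern axis g = inj₁ g
pattern transversal i j = inj₂ (i , j)

_≟ᴾ_ : DecidableEquality Point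
_≟ᴾ_ = Maybe.≡-dec (Product.≡-dec _≟_ _≟_)

_≟ᴸ_ : DecidableEquality Line
_≟ᴸ_ = Sum.≡-dec _≟_ (Product.≡-dec _≟_ _≟_)

Incident : F3 → Point → Line → Set
Incident s centre (axis g) = ⊤
Incident s centre (transversal i j) = Empty
Incident s (mark g k) (axis h) = g ≡ h
Incident s (mark g k) (transversal i j) = k ≡ coordinate s g i j

incident? : ∀ s p ℓ → Dec (Incident s p ℓ)
incident? s centre (axis g) = yes tt
incident? s centre (transversal i j) = no λ ()
incident? s (mark g k) (axis h) = g ≟ h
incident? s (mark g k) (transversal i j) = k ≟ coordinate s g i j

record Labelling (s : F3) : Set where
  field
    point : Fin 13 → Point
    line : Fin 13 → Line
    point-injective : Injective _≡_ _≡_ point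
    incident : ∀ k {x} → x ∈ₗ L3pts k → Incident s (point x) (line k)
    line-onto : ∀ ℓ → ∃ λ k → line k ≡ ℓ

module _ (s : F3) (point : Vec Point 13) (line : Vec Line 13) where

  LabellingTable : Set
  LabellingTable = (∀ x y → lookup point x ≡ lookup point y → x ≡ y)
    × (∀ k → All (λ x → Incident s (lookup point x) (lookup line k)) (L3pts k))
    × (∀ g → ∃ λ k → lookup line k ≡ axis g)
    × (∀ i j → ∃ λ k → lookup line k ≡ transversal i j)

  labellingTable? : Dec LabellingTable
  labellingTable? = (all? λ x → all? λ y → (lookup point x ≟ᴾ lookup point y) →-dec (x ≟ y))
    ×-dec (all? λ k → All.all? (λ x → incident? s (lookup point x) (lookup line k)) (L3pts k))
    ×-dec (all? λ g → any? λ k → lookup line k ≟ᴸ axis g)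
    ×-dec (all? λ i → all? λ j → any? λ k → lookup line k ≟ᴸ transversal i j)

  fromTable : LabellingTable → Labelling s
  fromTable (injective , incident , onto-axis , onto-transversal) = record
    { point = lookup point
    ; line = lookup line
    ; point-injective = λ {x} {y} → injective x y
    ; incident = λ k → All.lookup (incident k)
    ; line-onto = λ { (axis g) → onto-axis g ; (transversal i j) → onto-transversal i j }
    }

-- In both tables the axes are the lines 0, 10, 12 and 4 of 𝓛₃, the four lines through 0.
labelling₁ : Labelling 1F
labelling₁ = fromTable 1F points lines (from-yes (labellingTable? 1F points lines))
  where
    points = centre ∷ mark 0F 0F ∷ mark 2F 0F ∷ mark 0F 1F ∷ mark 3F 0F ∷ mark 3F 2F ∷ mark 1F 1F
           ∷ mark 3F 1F ∷ mark 2F 1F ∷ mark 0F 2F ∷ mark 1F 0F ∷ mark 1F 2F ∷ mark 2F 2F ∷ []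
    lines = axis 0F ∷ transversal 0F 0F ∷ transversal 1F 2F ∷ transversal 1F 1F ∷ axis 3F
          ∷ transversal 0F 1F ∷ transversal 2F 1F ∷ transversal 1F 0F ∷ transversal 2F 2F
          ∷ transversal 2F 0F ∷ axis 1F ∷ transversal 0F 2F ∷ axis 2F ∷ []

labelling₂ : Labelling 2F
labelling₂ = fromTable 2F points lines (from-yes (labellingTable? 2F points lines))
  where
    points = centre ∷ mark 0F 0F ∷ mark 2F 0F ∷ mark 0F 2F ∷ mark 3F 0F ∷ mark 3F 1F ∷ mark 1F 1F
           ∷ mark 3F 2F ∷ mark 2F 1F ∷ mark 0F 1F ∷ mark 1F 0F ∷ mark 1F 2F ∷ mark 2F 2F ∷ []
    lines = axis 0F ∷ transversal 0F 0F ∷ transversal 2F 2F ∷ transversal 2F 1F ∷ axis 3F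
          ∷ transversal 0F 1F ∷ transversal 1F 1F ∷ transversal 2F 0F ∷ transversal 1F 2F
          ∷ transversal 1F 0F ∷ axis 1F ∷ transversal 0F 2F ∷ axis 2F ∷ []

labelling : ∀ {s} → s ≡ 1F ⊎ s ≡ 2F → Labelling s
labelling (inj₁ refl) = labelling₁
labelling (inj₂ refl) = labelling₂

L3pts-unique : ∀ k → Unique (L3pts k)
L3pts-unique = from-yes (all? λ k → allPairs? (λ x y → ¬? (x ≟ y)) (L3pts k))

-- Families with γ₃ ≥ 3 meeting pairwise once

module Plane (𝓕 : Family n) (𝓕! : Unique 𝓕) (four : FourUniform 𝓕)
             (γ : γ₃≥ 3 𝓕) (meet-once : PairwiseMeetOnce 𝓕) where

  private
    variable
      F G : Subset n

  IsLine : Subset n → Set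
  IsLine F = F ∈ₗ 𝓕

  ∣line∣≡4 : IsLine F → ∣ F ∣ ≡ 4
  ∣line∣≡4 F-line = All.lookup four F-line

  ∣line-x∣≡3 : IsLine F → x ∈ F → ∣ F - x ∣ ≡ 3
  ∣line-x∣≡3 F-line x∈F = suc-injective (trans (x∈p⇒suc∣p-x∣≡∣p∣ x∈F) (∣line∣≡4 F-line))

  opaque
    common-point : IsLine F → IsLine G → F ≢ G → ∃ λ x → x ∈ F × x ∈ G
    common-point {F} {G} F-line G-line F≢G with ∣p∣≡suc⇒nonempty (F ∩ G) (meet-once F-line G-line F≢G)
    ... | x , x∈F∩G = x , x∈p∩q⁻ F G x∈F∩G

  common-point-unique : IsLine F → IsLine G → F ≢ G → x ∈ F → x ∈ G → y ∈ F → y ∈ G → y ≡ x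
  common-point-unique {x = x} F-line G-line F≢G x∈F x∈G y∈F y∈G =
    proj₂ (injection-covers {e = λ (_ : Fin 1) → x} (λ { {zero} {zero} _ → refl })
      (λ _ → x∈p∩q⁺ (x∈F , x∈G)) (≤-reflexive (meet-once F-line G-line F≢G)) (x∈p∩q⁺ (y∈F , y∈G)))

  two-points-determine-line : IsLine F → IsLine G → x ≢ y → x ∈ F → y ∈ F → x ∈ G → y ∈ G → F ≡ G
  two-points-determine-line {F} {G} F-line G-line x≢y x∈F y∈F x∈G y∈G =
    decidable-stable (F ≟S G) λ F≢G →
      x≢y (sym (common-point-unique F-line G-line F≢G x∈F x∈G y∈F y∈G))

  lines-avoiding : (S : Subset n) → ∣ S ∣ ≡ 3 → Σ (Fin 3 → Subset n) λ ℓ →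
    Injective _≡_ _≡_ ℓ × (∀ i → IsLine (ℓ i)) × (∀ i → ℓ i ∩ S ≡ ⊥)
  lines-avoiding S ∣S∣≡3 with pick-distinct (filter⁺ (λ G → (G ∩ S) ≟S ⊥) 𝓕!) (γ S ∣S∣≡3)
  ... | ℓ , ℓ-injective , ℓ∈ = ℓ , ℓ-injective , (proj₁ ∘ avoids) , (proj₂ ∘ avoids)
    where avoids = λ i → ∈-filter⁻ (λ G → (G ∩ S) ≟S ⊥) (ℓ∈ i)

  some-line : 3 ≤ n → ∃ IsLine
  some-line 3≤n = proj₁ avoiding 0F , proj₁ (proj₂ (proj₂ avoiding)) 0F
    where
      S : Subset n
      S = image (λ i → inject≤ i 3≤n) (allFin 3)
      ∣S∣≡3 : ∣ S ∣ ≡ 3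
      ∣S∣≡3 = trans (∣image∣≡length (inject≤-injective 3≤n 3≤n _ _) (allFin⁺ 3))
                    (length-tabulate (λ i → i))
      avoiding = lines-avoiding S ∣S∣≡3

  record Pencil (x : Fin n) : Set where
    field
      line : Fin 4 → Subset n
      line-injective : Injective _≡_ _≡_ line
      isLine : ∀ g → IsLine (line g)
      through : ∀ g → x ∈ line g

  -- The three lines missing F - x must meet F, and can only do so at x.
  pencil : IsLine F → x ∈ F → Pencil x
  pencil {F} {x} F-line x∈F with lines-avoiding (F - x) (∣line-x∣≡3 F-line x∈F)
  ... | ℓ , ℓ-injective , ℓ-line , ℓ-avoids = record
    { line = F ◃ ℓ
    ; line-injective = injective-◃ ℓ-injective ℓ≢F
    ; isLine = λ { zero → F-line ; (suc i) → ℓ-line i }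
    ; through = λ { zero → x∈F ; (suc i) → x∈ℓ i }
    }
    where
      ℓ-misses : ∀ i → y ∈ ℓ i → y ∉ F - x
      ℓ-misses i y∈ℓ y∈F-x = ∉⊥ (subst (_ ∈_) (ℓ-avoids i) (x∈p∩q⁺ (y∈ℓ , y∈F-x)))
      ℓ≢F : ∀ i → ℓ i ≢ F
      ℓ≢F i ℓ≡F with ∣p∣≡suc⇒nonempty (F - x) (∣line-x∣≡3 F-line x∈F)
      ... | y , y∈F-x = ℓ-misses i (subst (y ∈_) (sym ℓ≡F) (p─q⊆p F _ y∈F-x)) y∈F-x
      x∈ℓ : ∀ i → x ∈ ℓ i
      x∈ℓ i with common-point (ℓ-line i) F-line (ℓ≢F i)
      ... | y , y∈ℓ , y∈F with y ≟ x
      ...   | yes refl = y∈ℓ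
      ...   | no y≢x = contradiction (x∈p∧x≢y⇒x∈p-y y∈F y≢x) (ℓ-misses i y∈ℓ)

  -- The four lines through x meet M in four distinct points, which exhaust M.
  opaque
    join : ∀ {L M} → IsLine L → x ∈ L → IsLine M → x ∉ M → y ∈ M → ∃ λ H → IsLine H × x ∈ H × y ∈ H
    join {x} {y} {M = M} L-line x∈L M-line x∉M y∈M =
      line g , isLine g , through g , subst (_∈ line g) (sym y≡m) (m∈line g)
      where
        open Pencil (pencil L-line x∈L)
        line≢M : ∀ g → line g ≢ M
        line≢M g line≡M = x∉M (subst (x ∈_) line≡M (through g))
        meet : ∀ g → ∃ λ z → z ∈ line g × z ∈ M
        meet g = common-point (isLine g) M-line (line≢M g)
        m : Fin 4 → Fin n
        m g = proj₁ (meet g)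
        m∈line : ∀ g → m g ∈ line g
        m∈line g = proj₁ (proj₂ (meet g))
        m∈M : ∀ g → m g ∈ M
        m∈M g = proj₂ (proj₂ (meet g))
        m-injective : Injective _≡_ _≡_ m
        m-injective {g} {h} mg≡mh = line-injective (two-points-determine-line (isLine g) (isLine h)
          (λ x≡mg → x∉M (subst (_∈ M) (sym x≡mg) (m∈M g)))
          (through g) (m∈line g) (through h) (subst (_∈ line h) (sym mg≡mh) (m∈line h)))
        covered : ∃ λ g → y ≡ m g
        covered = injection-covers m-injective m∈M (≤-reflexive (∣line∣≡4 M-line)) y∈M
        g : Fin 4
        g = proj₁ covered
        y≡m : y ≡ m g
        y≡m = proj₂ covered

  record Realisation (s : F3) : Set where
    field
      point : Point → Fin n
      line : Line → Subset n
      point-injective : Injective _≡_ _≡_ point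
      isLine : ∀ ℓ → IsLine (line ℓ)
      incident : ∀ {p ℓ} → Incident s p ℓ → point p ∈ line ℓ
      exhaustive : IsLine F → ∃ λ ℓ → F ≡ line ℓ

  module Coordinates (o : Fin n) (P : Pencil o) where

    open Pencil P renaming (line to L; line-injective to L-injective; isLine to L-line; through to o∈L)

    off-axis : ∀ {g h} → x ∈ L g → x ≢ o → g ≢ h → x ∉ L h
    off-axis {g = g} {h} x∈Lg x≢o g≢h x∈Lh = g≢h (L-injective
      (two-points-determine-line (L-line g) (L-line h) x≢o x∈Lg (o∈L g) x∈Lh (o∈L h)))

    same-axis : ∀ {g h} → x ∈ L g → x ≢ o → x ∈ L h → g ≡ h
    same-axis {g = g} {h} x∈Lg x≢o x∈Lh =
      decidable-stable (g ≟ h) (λ g≢h → off-axis x∈Lg x≢o g≢h x∈Lh)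

    labels : ∀ g → Σ (F3 → Fin n) λ e → Injective _≡_ _≡_ e × (∀ k → e k ∈ L g - o)
    labels g = enumerate (L g - o) (∣line-x∣≡3 (L-line g) (o∈L g))

    a c : F3 → Fin n
    a = proj₁ (labels 0F)
    c = proj₁ (labels 1F)

    a-injective : Injective _≡_ _≡_ a
    a-injective = proj₁ (proj₂ (labels 0F))

    c-injective : Injective _≡_ _≡_ c
    c-injective = proj₁ (proj₂ (labels 1F))

    a∈L-o : ∀ i → a i ∈ L 0F - o
    a∈L-o = proj₂ (proj₂ (labels 0F))

    c∈L-o : ∀ j → c j ∈ L 1F - o
    c∈L-o = proj₂ (proj₂ (labels 1F))

    a∈L : ∀ i → a i ∈ L 0F
    a∈L i = p─q⊆p _ _ (a∈L-o i)

    c∈L : ∀ j → c j ∈ L 1F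
    c∈L j = p─q⊆p _ _ (c∈L-o j)

    a∉L1 : ∀ i → a i ∉ L 1F
    a∉L1 i = off-axis (a∈L i) (x∈p-y⇒x≢y (a∈L-o i)) λ ()

    line-through-a-c : ∀ i j → ∃ λ H → IsLine H × a i ∈ H × c j ∈ H
    line-through-a-c i j = join (L-line 0F) (a∈L i) (L-line 1F) (a∉L1 i) (c∈L j)

    T : F3 → F3 → Subset n
    T i j = proj₁ (line-through-a-c i j)

    T-line : ∀ i j → IsLine (T i j)
    T-line i j = proj₁ (proj₂ (line-through-a-c i j))

    a∈T : ∀ i j → a i ∈ T i j
    a∈T i j = proj₁ (proj₂ (proj₂ (line-through-a-c i j)))

    c∈T : ∀ i j → c j ∈ T i j
    c∈T i j = proj₂ (proj₂ (proj₂ (line-through-a-c i j)))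

    o∉T : ∀ i j → o ∉ T i j
    o∉T i j o∈T = a∉L1 i (subst (a i ∈_) T≡L1 (a∈T i j))
      where
        T≡L1 : T i j ≡ L 1F
        T≡L1 = two-points-determine-line (T-line i j) (L-line 1F) (x∈p-y⇒x≢y (c∈L-o j) ∘ sym)
          o∈T (c∈T i j) (o∈L 1F) (c∈L j)

    T≢L : ∀ i j g → T i j ≢ L g
    T≢L i j g T≡L = o∉T i j (subst (o ∈_) (sym T≡L) (o∈L g))

    T-meets-L-once : ∀ i j g → x ∈ T i j → x ∈ L g → y ∈ T i j → y ∈ L g → y ≡ x
    T-meets-L-once i j g = common-point-unique (T-line i j) (L-line g) (T≢L i j g)

    T-injective : ∀ i j i' j' → T i j ≡ T i' j' → i ≡ i' × j ≡ j'
    T-injective i j i' j' T≡T' =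
        a-injective (T-meets-L-once i j 0F (subst (a i' ∈_) (sym T≡T') (a∈T i' j')) (a∈L i')
                                           (a∈T i j) (a∈L i))
      , c-injective (T-meets-L-once i j 1F (subst (c j' ∈_) (sym T≡T') (c∈T i' j')) (c∈L j')
                                           (c∈T i j) (c∈L j))

    transversals-share : ∀ {g h} i j i' j' → g ≢ h → x ∈ L g → x ≢ o → y ∈ L h
      → x ∈ T i j → y ∈ T i j → x ∈ T i' j' → y ∈ T i' j' → i ≡ i' × j ≡ j'
    transversals-share i j i' j' g≢h x∈Lg x≢o y∈Lh x∈T y∈T x∈T' y∈T' =
      T-injective i j i' j' (two-points-determine-line (T-line i j) (T-line i' j')
        (λ x≡y → off-axis x∈Lg x≢o g≢h (subst (_∈ L _) (sym x≡y) y∈Lh)) x∈T y∈T x∈T' y∈T')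

    crossing : ∀ g i j → ∃ λ x → x ∈ L g × x ∈ T i j
    crossing g i j = common-point (L-line g) (T-line i j) (T≢L i j g ∘ sym)

    cross : Fin 4 → F3 → F3 → Fin n
    cross g i j = proj₁ (crossing g i j)

    cross∈L : ∀ g i j → cross g i j ∈ L g
    cross∈L g i j = proj₁ (proj₂ (crossing g i j))

    cross∈T : ∀ g i j → cross g i j ∈ T i j
    cross∈T g i j = proj₂ (proj₂ (crossing g i j))

    cross≢o : ∀ g i j → cross g i j ≢ o
    cross≢o g i j cross≡o = o∉T i j (subst (_∈ T i j) cross≡o (cross∈T g i j))

    pt : Fin 4 → F3 → Fin n
    pt 0F = a
    pt 1F = c
    pt 2F k = cross 2F 0F k
    pt 3F k = cross 3F k 0F

    pt∈L : ∀ g k → pt g k ∈ L g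
    pt∈L 0F = a∈L
    pt∈L 1F = c∈L
    pt∈L 2F k = cross∈L 2F 0F k
    pt∈L 3F k = cross∈L 3F k 0F

    pt≢o : ∀ g k → pt g k ≢ o
    pt≢o 0F i = x∈p-y⇒x≢y (a∈L-o i)
    pt≢o 1F j = x∈p-y⇒x≢y (c∈L-o j)
    pt≢o 2F k = cross≢o 2F 0F k
    pt≢o 3F k = cross≢o 3F k 0F

    pt-injective : ∀ g → Injective _≡_ _≡_ (pt g)
    pt-injective 0F = a-injective
    pt-injective 1F = c-injective
    pt-injective 2F {k} {k'} e = proj₂ (transversals-share {g = 0F} {h = 2F} 0F k 0F k' (λ ())
      (a∈L 0F) (pt≢o 0F 0F) (cross∈L 2F 0F k) (a∈T 0F k) (cross∈T 2F 0F k) (a∈T 0F k')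
      (subst (_∈ T 0F k') (sym e) (cross∈T 2F 0F k')))
    pt-injective 3F {k} {k'} e = proj₁ (transversals-share {g = 1F} {h = 3F} k 0F k' 0F (λ ())
      (c∈L 0F) (pt≢o 1F 0F) (cross∈L 3F k 0F) (c∈T k 0F) (cross∈T 3F k 0F) (c∈T k' 0F)
      (subst (_∈ T k' 0F) (sym e) (cross∈T 3F k' 0F)))

    pt-covers : ∀ g → y ∈ L g → y ≢ o → ∃ λ k → y ≡ pt g k
    pt-covers g y∈L y≢o = injection-covers (pt-injective g)
      (λ k → x∈p∧x≢y⇒x∈p-y (pt∈L g k) (pt≢o g k))
      (≤-reflexive (∣line-x∣≡3 (L-line g) (o∈L g))) (x∈p∧x≢y⇒x∈p-y y∈L y≢o)

    κ : Fin 4 → F3 → F3 → F3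
    κ g i j = proj₁ (pt-covers g (cross∈L g i j) (cross≢o g i j))

    cross≡pt-κ : ∀ g i j → cross g i j ≡ pt g (κ g i j)
    cross≡pt-κ g i j = proj₂ (pt-covers g (cross∈L g i j) (cross≢o g i j))

    κ-orthogonal : PairwiseOrthogonal κ
    κ-orthogonal g h g≢h i j i' j' κg≡ κh≡ =
      transversals-share i j i' j' g≢h (cross∈L g i j) (cross≢o g i j) (cross∈L h i j)
        (cross∈T g i j) (cross∈T h i j) (moves g κg≡) (moves h κh≡)
      where
        moves : ∀ g → κ g i j ≡ κ g i' j' → cross g i j ∈ T i' j'
        moves g κ≡ = subst (_∈ T i' j')
          (sym (trans (cross≡pt-κ g i j) (trans (cong (pt g) κ≡) (sym (cross≡pt-κ g i' j')))))
          (cross∈T g i' j')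

    κ₀ : ∀ i j → κ 0F i j ≡ i
    κ₀ i j = a-injective (trans (sym (cross≡pt-κ 0F i j))
      (T-meets-L-once i j 0F (a∈T i j) (a∈L i) (cross∈T 0F i j) (cross∈L 0F i j)))

    κ₁ : ∀ i j → κ 1F i j ≡ j
    κ₁ i j = c-injective (trans (sym (cross≡pt-κ 1F i j))
      (T-meets-L-once i j 1F (c∈T i j) (c∈L j) (cross∈T 1F i j) (cross∈L 1F i j)))

    κ₂ : ∀ j → κ 2F 0F j ≡ j
    κ₂ j = pt-injective 2F (sym (cross≡pt-κ 2F 0F j))

    κ₃ : ∀ i → κ 3F i 0F ≡ i
    κ₃ i = pt-injective 3F (sym (cross≡pt-κ 3F i 0F))

    normalised : ∃ λ s → (s ≡ 1F ⊎ s ≡ 2F) × (∀ g i j → κ g i j ≡ coordinate s g i j)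
    normalised = normal-form κ-orthogonal (κ₀ , κ₁ , κ₂ , κ₃)

    s : F3
    s = proj₁ normalised

    point : Point → Fin n
    point centre = o
    point (mark g k) = pt g k

    line : Line → Subset n
    line (axis g) = L g
    line (transversal i j) = T i j

    point-injective : Injective _≡_ _≡_ point
    point-injective {centre} {centre} _ = refl
    point-injective {centre} {mark g k} o≡pt = contradiction (sym o≡pt) (pt≢o g k)
    point-injective {mark g k} {centre} pt≡o = contradiction pt≡o (pt≢o g k)
    point-injective {mark g k} {mark h k'} pt≡pt
      with same-axis (pt∈L g k) (pt≢o g k) (subst (_∈ L h) (sym pt≡pt) (pt∈L h k'))
    ... | refl = cong (mark g) (pt-injective g pt≡pt)

    line-isLine : ∀ ℓ → IsLine (line ℓ)
    line-isLine (axis g) = L-line g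
    line-isLine (transversal i j) = T-line i j

    incident : ∀ {p ℓ} → Incident s p ℓ → point p ∈ line ℓ
    incident {centre} {axis g} _ = o∈L g
    incident {mark g k} {axis .g} refl = pt∈L g k
    incident {mark g _} {transversal i j} refl =
      subst (λ k → pt g k ∈ T i j) (proj₂ (proj₂ normalised) g i j)
        (subst (_∈ T i j) (cross≡pt-κ g i j) (cross∈T g i j))

    lines-through-o : IsLine F → o ∈ F → ∃ λ g → F ≡ L g
    lines-through-o {F} F-line o∈F =
      g , two-points-determine-line F-line (L-line g) (z≢o ∘ sym) o∈F z∈F (o∈L g) z∈Lg
      where
        F≢T : F ≢ T 0F 0F
        F≢T F≡T = o∉T 0F 0F (subst (o ∈_) F≡T o∈F)
        meet : ∃ λ z → z ∈ F × z ∈ T 0F 0F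
        meet = common-point F-line (T-line 0F 0F) F≢T
        z : Fin n
        z = proj₁ meet
        z∈F : z ∈ F
        z∈F = proj₁ (proj₂ meet)
        z∈T : z ∈ T 0F 0F
        z∈T = proj₂ (proj₂ meet)
        z≢o : z ≢ o
        z≢o z≡o = o∉T 0F 0F (subst (_∈ T 0F 0F) z≡o z∈T)
        cross-injective : Injective _≡_ _≡_ (λ g → cross g 0F 0F)
        cross-injective {g} {h} e =
          same-axis (cross∈L g 0F 0F) (cross≢o g 0F 0F) (subst (_∈ L h) (sym e) (cross∈L h 0F 0F))
        covered : ∃ λ g → z ≡ cross g 0F 0F
        covered = injection-covers cross-injective
          (λ g → cross∈T g 0F 0F) (≤-reflexive (∣line∣≡4 (T-line 0F 0F))) z∈T
        g : Fin 4
        g = proj₁ covered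
        z∈Lg : z ∈ L g
        z∈Lg = subst (_∈ L g) (sym (proj₂ covered)) (cross∈L g 0F 0F)

    lines-missing-o : IsLine F → o ∉ F → ∃₂ λ i j → F ≡ T i j
    lines-missing-o {F} F-line o∉F = i , j , two-points-determine-line F-line (T-line i j)
      (λ ai≡cj → a∉L1 i (subst (_∈ L 1F) (sym ai≡cj) (c∈L j))) ai∈F cj∈F (a∈T i j) (c∈T i j)
      where
        meets : ∀ g → ∃ λ k → pt g k ∈ F
        meets g with common-point F-line (L-line g) (λ F≡L → o∉F (subst (o ∈_) (sym F≡L) (o∈L g)))
        ... | x , x∈F , x∈L with pt-covers g x∈L (λ x≡o → o∉F (subst (_∈ F) x≡o x∈F))
        ...   | k , x≡pt = k , subst (_∈ F) x≡pt x∈F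
        i j : F3
        i = proj₁ (meets 0F)
        j = proj₁ (meets 1F)
        ai∈F : a i ∈ F
        ai∈F = proj₂ (meets 0F)
        cj∈F : c j ∈ F
        cj∈F = proj₂ (meets 1F)

    exhaustive : IsLine F → ∃ λ ℓ → F ≡ line ℓ
    exhaustive {F} F-line with o ∈? F
    ... | yes o∈F = axis (proj₁ (lines-through-o F-line o∈F)) , proj₂ (lines-through-o F-line o∈F)
    ... | no o∉F with lines-missing-o F-line o∉F
    ...   | i , j , F≡T = transversal i j , F≡T

    realisation : Realisation s
    realisation = record
      { point = point ; line = line ; point-injective = point-injective ; isLine = line-isLine
      ; incident = incident ; exhaustive = exhaustive }

  realisation-exists : 3 ≤ n → ∃ λ s → (s ≡ 1F ⊎ s ≡ 2F) × Realisation s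
  realisation-exists 3≤n = s , proj₁ (proj₂ normalised) , realisation
    where
      L₀ : Subset n
      L₀ = proj₁ (some-line 3≤n)
      L₀-line : IsLine L₀
      L₀-line = proj₂ (some-line 3≤n)
      point-of-L₀ : Nonempty L₀
      point-of-L₀ = ∣p∣≡suc⇒nonempty L₀ (∣line∣≡4 L₀-line)
      open Coordinates (proj₁ point-of-L₀) (pencil L₀-line (proj₂ point-of-L₀))

  realisation⇒IsoL3 : ∀ {s} → Realisation s → Labelling s → IsoL3 𝓕
  realisation⇒IsoL3 R Λ =
    f , f-injective , (λ k → subst IsLine (sym (image≡line k)) (isLine (Λ.line k))) , onto
    where
      open Realisation R
      module Λ = Labelling Λ
      f : Fin 13 → Fin n
      f = point ∘ Λ.point
      f-injective : Injective _≡_ _≡_ f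
      f-injective = Λ.point-injective ∘ point-injective
      image≡line : ∀ k → imageLine f k ≡ line (Λ.line k)
      image≡line k = ⊆-antisym image⊆line (p⊆q∧∣q∣≤∣p∣⇒q⊆p image⊆line (≤-reflexive
        (trans (∣line∣≡4 (isLine (Λ.line k))) (sym (∣image∣≡length f-injective (L3pts-unique k))))))
        where
          image⊆line : imageLine f k ⊆ line (Λ.line k)
          image⊆line y∈ with ∈-image⁻ (L3pts k) y∈
          ... | x , x∈ , refl = incident (Λ.incident k x∈)
      onto : F ∈ₗ 𝓕 → ∃ λ k → F ≡ imageLine f k
      onto F-line with exhaustive F-line
      ... | ℓ , F≡ℓ with Λ.line-onto ℓ
      ...   | k , refl = k , trans F≡ℓ (sym (image≡line k))

lemma4p1 : (n : ℕ) → 3 ≤ n → (𝓕 : Family n) → Unique 𝓕 → FourUniform 𝓕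
    → γ₃≥ 3 𝓕 → PairwiseMeetOnce 𝓕 → IsoL3 𝓕
lemma4p1 n 3≤n 𝓕 𝓕! four γ meet-once = realisation⇒IsoL3 R (labelling s∈)
  where
    open Plane 𝓕 𝓕! four γ meet-once
    s∈ = proj₁ (proj₂ (realisation-exists 3≤n))
    R = proj₂ (proj₂ (realisation-exists 3≤n))
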